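{- For every $c\in\mathbb{N}$ there exist infinitely many $n\in\mathbb{N}$ for which there is an $n$-vertex graph $G$ with $\mathrm{td}(G)\le\sqrt n$ such that for every graph $H$ and integer $m\le c\sqrt n$, if $G$ is contained in $H\boxtimes K_m$ then $\omega(H)\ge\frac{\log n}{4\log(c\log n)}$.
   Context: Logarithms are binary. $\omega(H)$ is the clique number of $H$. The tree-depth $\mathrm{td}(G)$ is the minimum number of vertices on a longest root-to-leaf path of a rooted forest $F$ such that $G$ is a subgraph of the closure of $F$ (ancestor–descendant pairs joined). The strong product $A\boxtimes B$ has vertex set $V(A)\times V(B)$, with distinct $(v,x),(w,y)$ adjacent iff ($v=w$ and $xy\in E(B)$) or ($x=y$ and $vw\in E(A)$) or ($vw\in E(A)$ and $xy\in E(B)$). Contained means isomorphic to a subgraph. -}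

module Defs where

open import Data.Nat using (ℕ; zero; suc; _+_; _*_; _^_; _≤_; _<_)
open import Data.Fin using (Fin)
open import Data.Maybe using (Maybe; just; nothing)
open import Data.Product using (Σ; _×_; _,_)
open import Data.Sum using (_⊎_; inj₁; inj₂)
open import Data.Empty using (⊥)
open import Relation.Nullary using (¬_)
open import Relation.Binary.PropositionalEquality using (_≡_; _≢_; refl; sym)
open import Function.Definitions using (Injective)

record Graph (V : Set) : Set₁ where
  field
    E      : V → V → Set
    E-sym    : ∀ {u v} → E u v → E v u
    E-irrefl : ∀ {v} → ¬ E v v
open Graph public

K : (m : ℕ) → Graph (Fin m)
K m = record { E = λ x y → x ≢ y ; E-sym = λ p q → p (sym q) ; E-irrefl = λ p → p refl }

_⊠_ : ∀ {V W} → Graph V → Graph W → Graph (V × W)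
_⊠_ {V} {W} A B = record { E = Eₚ ; E-sym = symₚ ; E-irrefl = irreflₚ }
  where
  Eₚ : V × W → V × W → Set
  Eₚ (v , x) (w , y) = (v ≡ w × E B x y) ⊎ ((x ≡ y × E A v w) ⊎ (E A v w × E B x y))
  symₚ : ∀ {p q} → Eₚ p q → Eₚ q p
  symₚ (inj₁ (refl , e)) = inj₁ (refl , Graph.E-sym B e)
  symₚ (inj₂ (inj₁ (refl , e))) = inj₂ (inj₁ (refl , Graph.E-sym A e))
  symₚ (inj₂ (inj₂ (e , f))) = inj₂ (inj₂ (Graph.E-sym A e , Graph.E-sym B f))
  irreflₚ : ∀ {p} → ¬ Eₚ p p
  irreflₚ (inj₁ (_ , e)) = Graph.E-irrefl B e
  irreflₚ (inj₂ (inj₁ (_ , e))) = Graph.E-irrefl A e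
  irreflₚ (inj₂ (inj₂ (e , _))) = Graph.E-irrefl A e

Contained : ∀ {V W} → Graph V → Graph W → Set
Contained {V} {W} G H =
  Σ (V → W) λ f → Injective _≡_ _≡_ f × (∀ u v → E G u v → E H (f u) (f v))

HasClique : ∀ {V} → Graph V → ℕ → Set
HasClique {V} H k =
  Σ (Fin k → V) λ f → Injective _≡_ _≡_ f × (∀ i j → i ≢ j → E H (f i) (f j))

-- A rooted forest on Fin k: each vertex has a parent or is a root; the
-- depth labelling (number of vertices on the path from the root) witnesses
-- acyclicity.
record RootedForest (k : ℕ) : Set where
  field
    parent     : Fin k → Maybe (Fin k)
    depth      : Fin k → ℕ
    depth-root : ∀ v → parent v ≡ nothing → depth v ≡ 1
    depth-step : ∀ v u → parent v ≡ just u → depth v ≡ suc (depth u)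
open RootedForest public

data Ancestor {k : ℕ} (F : RootedForest k) (u : Fin k) : Fin k → Set where
  par  : ∀ {v} → parent F v ≡ just u → Ancestor F u v
  step : ∀ {v w} → parent F v ≡ just w → Ancestor F u w → Ancestor F u v

ClosureEdge : ∀ {k} → RootedForest k → Fin k → Fin k → Set
ClosureEdge F u v = Ancestor F u v ⊎ Ancestor F v u

-- td(G) ≤ t : G is a subgraph of the closure of a rooted forest F whose
-- longest root-to-leaf path has at most t vertices.
TreeDepth≤ : ∀ {V} → Graph V → ℕ → Set
TreeDepth≤ {V} G t =
  Σ ℕ λ k → Σ (RootedForest k) λ F →
    (∀ v → depth F v ≤ t) ×
    Σ (V → Fin k) λ f → Injective _≡_ _≡_ f ×
      (∀ u v → E G u v → ClosureEdge F (f u) (f v))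

-- The real-valued bound  k ≥ log n / (4 log (c log n))  (binary logs),
-- encoded over ℕ: for c · log n > 1 it is equivalent to
-- n ≤ (c log n)^(4k), i.e. n^(1/(4k)) / c ≤ log n, i.e. every rational
-- p/q below n^(1/(4k))/c satisfies 2^p ≤ n^q.
LogBound : (n c k : ℕ) → Set
LogBound n c k =
  ∀ p q → 0 < q → (p * c) ^ (4 * k) < n * q ^ (4 * k) → 2 ^ p ≤ n ^ q

{-# OPTIONS --safe #-}
-- G is the closure of a forest T_D, where T_0 is empty and T_(d+1) consists of b disjoint
-- copies of a path of s vertices placed above T_d, so td(G) ≤ D·s. Suppose G embeds in
-- H ⊠ K_m with (i + D)·m < b·s and S is an i-clique of H each of whose vertices is equal or
-- adjacent to the H-coordinate of every vertex of G. The b·s vertices of the top paths have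
-- distinct images, so at most i·m of them have their H-coordinate in S; another one has an
-- H-coordinate w adjacent to all of S. Every vertex of the copy of T_(D-1) below it is adjacent
-- to it in the closure, so has H-coordinate equal or adjacent to w: add w to S and recurse,
-- ending with a D-clique.
-- For D = N + 1, B = 2Dc, b = B², s = b^N one has b·s² ≤ n ≤ 2·b·s², hence (D·s)² ≤ n and
-- D·m < b·s whenever m² ≤ c²·n; finally n ≤ B^(4D) and 2^(2D) ≤ n give n ≤ (c log n)^(4D).
module Submission where

open import Defs
open import Data.Empty using (⊥; ⊥-elim)
open import Data.Fin using (Fin; zero; suc; remQuot; combine; fromℕ<) renaming (_≟_ to _≟ᶠ_)
open import Data.Fin.Properties
  using (0↔⊥; 1↔⊤; +↔⊎; *↔×; ¬Fin0; all?; any?; ¬∀⟶∃¬; injective⇒≤; combine-injective)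
open import Data.Maybe using (Maybe; just; nothing; maybe′)
import Data.Maybe as Maybe
open import Data.Maybe.Properties using (map-just; maybe′-map; maybe′-∘)
open import Data.Nat using (ℕ; zero; suc; _+_; _*_; _^_; _≤_; _<_; z≤n; s≤s; NonZero; >-nonZero⁻¹)
open import Data.Nat.Properties
open import Data.Nat.Tactic.RingSolver using (solve-∀)
open import Data.Product using (Σ; ∃; _×_; _,_; proj₁; proj₂)
open import Data.Product.Function.NonDependent.Propositional using (_×-↔_)
open import Data.Sum using (_⊎_; inj₁; inj₂; reduce; swap) renaming (map to ⊎-map)
open import Data.Sum.Function.Propositional using (_⊎-↔_)
open import Data.Unit using (⊤; tt)
open import Data.Vec.Functional using (_∷_)
open import Function using (_∘_; _↔_; Inverse)
open import Function.Bundles using (Injection)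
open import Function.Definitions using (Injective)
open import Function.Properties.Inverse using (↔-refl; ↔-sym; ↔-trans; ↔⇒↣)
open import Relation.Binary.Construct.Closure.Reflexive using (ReflClosure; refl; [_])
open import Relation.Binary.Construct.Closure.Transitive using (TransClosure; [_]) renaming (_∷_ to _◅_)
open import Relation.Binary.PropositionalEquality
  using (_≡_; _≢_; refl; sym; trans; cong; cong₂; subst; subst₂)
open import Relation.Nullary using (¬_; yes; no)
open import Relation.Nullary.Decidable using (decidable-stable)

comap : ∀ {A B : Set} → (A → B) → Graph B → Graph A
comap f G = record { E = λ u v → E G (f u) (f v) ; E-sym = E-sym G ; E-irrefl = E-irrefl G }

↔-injective : ∀ {A B : Set} (I : A ↔ B) → Injective _≡_ _≡_ (Inverse.to I)
↔-injective I = Injection.injective (↔⇒↣ I)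

Contained-trans : ∀ {U V W} {G : Graph U} {H : Graph V} {K : Graph W} →
                  Contained G H → Contained H K → Contained G K
Contained-trans (f , f-inj , f-hom) (g , g-inj , g-hom) =
  g ∘ f , f-inj ∘ g-inj , λ u v e → g-hom _ _ (f-hom u v e)

comap-Contained : ∀ {A B : Set} (I : A ↔ B) (G : Graph B) → Contained (comap (Inverse.to I) G) G
comap-Contained I G = Inverse.to I , ↔-injective I , λ _ _ e → e

Contained-comap : ∀ {A B : Set} (I : A ↔ B) (G : Graph B) → Contained G (comap (Inverse.to I) G)
Contained-comap I G = Inverse.from I , ↔-injective (↔-sym I) , λ u v e →
  subst₂ (E G) (sym (Inverse.strictlyInverseˡ I u)) (sym (Inverse.strictlyInverseˡ I v)) e

TreeDepth≤-mono : ∀ {U V} {G : Graph U} {G′ : Graph V} {t} →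
                  Contained G G′ → TreeDepth≤ G′ t → TreeDepth≤ G t
TreeDepth≤-mono (f , f-inj , f-hom) (k , F , F-depth≤ , g , g-inj , g-hom) =
  k , F , F-depth≤ , g ∘ f , f-inj ∘ g-inj , λ u v e → g-hom _ _ (f-hom u v e)

⊠-proj₁ : ∀ {V W} {A : Graph V} {B : Graph W} {v w x y} →
          E (A ⊠ B) (v , x) (w , y) → ReflClosure (E A) v w
⊠-proj₁ (inj₁ (refl , _))        = refl
⊠-proj₁ (inj₂ (inj₁ (_ , e)))    = [ e ]
⊠-proj₁ (inj₂ (inj₂ (e , _)))    = [ e ]

drop-refl-≢ : ∀ {A : Set} {R : A → A → Set} {x y} → x ≢ y → ReflClosure R x y → R x y
drop-refl-≢ x≢y refl  = ⊥-elim (x≢y refl)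
drop-refl-≢ _   [ r ] = r

Contained-⊠K0 : ∀ {U V} {G : Graph U} {H : Graph V} → Contained G (H ⊠ K 0) → ¬ U
Contained-⊠K0 (f , _) u = ¬Fin0 (proj₂ (f u))

Clique : ∀ {V} → Graph V → ℕ → Set
Clique {V} H i = Σ (Fin i → V) λ S → ∀ j j′ → j ≢ j′ → E H (S j) (S j′)

Clique⇒HasClique : ∀ {V} {H : Graph V} {i} → Clique H i → HasClique H i
Clique⇒HasClique {H = H} (S , S-adj) = S , S-injective , S-adj
  where
  S-injective : Injective _≡_ _≡_ S
  S-injective {j} {j′} S-eq = decidable-stable (j ≟ᶠ j′) λ j≢j′ →
    E-irrefl H (subst (E H (S j)) (sym S-eq) (S-adj j j′ j≢j′))

Clique-extend : ∀ {V} {H : Graph V} {i} (C : Clique H i) w →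
                (∀ j → E H w (proj₁ C j)) → Clique H (suc i)
Clique-extend {H = H} (S , S-adj) w w-adj = w ∷ S , adj
  where
  adj : ∀ j j′ → j ≢ j′ → E H ((w ∷ S) j) ((w ∷ S) j′)
  adj zero    zero     ne = ⊥-elim (ne refl)
  adj zero    (suc j′) _  = w-adj j′
  adj (suc j) zero     _  = E-sym H (w-adj j)
  adj (suc j) (suc j′) ne = S-adj j j′ (ne ∘ cong suc)

-- Were every proj₁ (f x) in S, x ↦ (its index in S , proj₂ (f x)) would inject Fin k into Fin (i * m).
outside-image : ∀ {h m i k} → i * m < k → (f : Fin k → Fin h × Fin m) → Injective _≡_ _≡_ f →
                (S : Fin i → Fin h) → ∃ λ x → ∀ j → proj₁ (f x) ≢ S j
outside-image {m = m} {i} {k} im<k f f-inj S with all? (λ x → any? (λ j → proj₁ (f x) ≟ᶠ S j))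
... | yes inS = ⊥-elim (<⇒≱ im<k (injective⇒≤ code-injective))
  where
  code : Fin k → Fin (i * m)
  code x = combine (proj₁ (inS x)) (proj₂ (f x))
  code-injective : Injective _≡_ _≡_ code
  code-injective {x} {y} eq with combine-injective _ _ _ _ eq
  ... | j≡j′ , f₂≡ =
    f-inj (cong₂ _,_ (trans (proj₂ (inS x)) (trans (cong S j≡j′) (sym (proj₂ (inS y))))) f₂≡)
... | no ¬inS with ¬∀⟶∃¬ k _ (λ x → any? λ j → proj₁ (f x) ≟ᶠ S j) ¬inS
...   | x , x∉S = x , λ j eq → x∉S (j , eq)

-- Rooted forests

-- RootedForest on an arbitrary vertex type, its two depth laws merged into one equation.
record Forest (V : Set) : Set where
  field
    parent       : V → Maybe V
    depth        : V → ℕ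
    depth-parent : ∀ v → depth v ≡ maybe′ (suc ∘ depth) 1 (parent v)
open Forest public

ChildOf : ∀ {V} → Forest V → V → V → Set
ChildOf F v u = parent F v ≡ just u

Descends : ∀ {V} → Forest V → V → V → Set
Descends F = TransClosure (ChildOf F)

module _ {V : Set} (F : Forest V) where

  child-depth : ∀ {v u} → ChildOf F v u → depth F v ≡ suc (depth F u)
  child-depth {v} e = trans (depth-parent F v) (cong (maybe′ (suc ∘ depth F) 1) e)

  Descends-depth : ∀ {v u} → Descends F v u → depth F u < depth F v
  Descends-depth [ e ]   = ≤-reflexive (sym (child-depth e))
  Descends-depth (e ◅ d) = <-trans (Descends-depth d) (≤-reflexive (sym (child-depth e)))

  closure : Graph V
  closure = record
    { E        = λ u v → Descends F v u ⊎ Descends F u v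
    ; E-sym    = swap
    ; E-irrefl = λ e → <-irrefl refl (Descends-depth (reduce e))
    }

Descends-map : ∀ {V U} (F : Forest V) (F′ : Forest U) (f : V → U) →
               (∀ {v u} → ChildOf F v u → ChildOf F′ (f v) (f u)) →
               ∀ {v u} → Descends F v u → Descends F′ (f v) (f u)
Descends-map F F′ f child [ e ]   = [ child e ]
Descends-map F F′ f child (e ◅ d) = child e ◅ Descends-map F F′ f child d

closure-map : ∀ {V U} (F : Forest V) (F′ : Forest U) (f : V → U) → Injective _≡_ _≡_ f →
              (∀ {v u} → ChildOf F v u → ChildOf F′ (f v) (f u)) →
              Contained (closure F) (closure F′)
closure-map F F′ f f-inj child =
  f , f-inj , λ _ _ → ⊎-map (Descends-map F F′ f child) (Descends-map F F′ f child)

toRootedForest : ∀ {k} → Forest (Fin k) → RootedForest k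
toRootedForest F = record
  { parent     = parent F
  ; depth      = depth F
  ; depth-root = λ v e → trans (depth-parent F v) (cong (maybe′ (suc ∘ depth F) 1) e)
  ; depth-step = λ v u → child-depth F
  }

Descends⇒Ancestor : ∀ {k} {F : Forest (Fin k)} {v u} → Descends F v u → Ancestor (toRootedForest F) u v
Descends⇒Ancestor [ e ]   = par e
Descends⇒Ancestor (e ◅ d) = step e (Descends⇒Ancestor d)

module _ {V U : Set} (I : V ↔ U) (F : Forest V) where
  open Inverse I

  transport : Forest U
  transport = record
    { parent       = Maybe.map to ∘ parent F ∘ from
    ; depth        = depth F ∘ from
    ; depth-parent = depth-parent′
    }
    where
    depth-parent′ : ∀ u →
      depth F (from u) ≡ maybe′ (suc ∘ depth F ∘ from) 1 (Maybe.map to (parent F (from u)))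
    depth-parent′ u with parent F (from u) | depth-parent F (from u)
    ... | nothing | d = d
    ... | just w  | d = trans d (cong (suc ∘ depth F) (sym (strictlyInverseʳ w)))

  transport-child : ∀ {v u} → ChildOf F v u → ChildOf transport (to v) (to u)
  transport-child {v} e = trans (cong (Maybe.map to ∘ parent F) (strictlyInverseʳ v)) (map-just e)

closure-TreeDepth≤ : ∀ {V k t} (I : V ↔ Fin k) (F : Forest V) →
                     (∀ v → depth F v ≤ t) → TreeDepth≤ (closure F) t
closure-TreeDepth≤ {k = k} I F depth≤ =
  k , toRootedForest (transport I F) , depth≤ ∘ Inverse.from I , Inverse.to I , ↔-injective I ,
  λ _ _ → ⊎-map ancestor ancestor
  where
  ancestor : ∀ {v u} → Descends F v u →
             Ancestor (toRootedForest (transport I F)) (Inverse.to I u) (Inverse.to I v)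
  ancestor = Descends⇒Ancestor ∘ Descends-map F (transport I F) (Inverse.to I) (transport-child I F)

emptyForest : Forest ⊥
emptyForest = record { parent = λ () ; depth = λ () ; depth-parent = λ () }

module _ {V : Set} (b : ℕ) (F : Forest V) where

  copies : Forest (Fin b × V)
  copies = record
    { parent       = λ (a , v) → Maybe.map (a ,_) (parent F v)
    ; depth        = λ (a , v) → depth F v
    ; depth-parent = λ (a , v) → trans (depth-parent F v) (sym (maybe′-map _ 1 (a ,_) (parent F v)))
    }

  copies-child : ∀ a {v u} → ChildOf F v u → ChildOf copies (a , v) (a , u)
  copies-child a = map-just

root : ∀ {V : Set} → ⊤ ⊎ V
root = inj₁ tt

module _ {V : Set} (F : Forest V) where

  addRoot : Forest (⊤ ⊎ V)
  addRoot = record { parent = parent′ ; depth = depth′ ; depth-parent = depth-parent′ }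
    where
    parent′ : ⊤ ⊎ V → Maybe (⊤ ⊎ V)
    parent′ (inj₁ _) = nothing
    parent′ (inj₂ v) = just (maybe′ inj₂ root (parent F v))
    depth′ : ⊤ ⊎ V → ℕ
    depth′ (inj₁ _) = 1
    depth′ (inj₂ v) = suc (depth F v)
    depth-parent′ : ∀ x → depth′ x ≡ maybe′ (suc ∘ depth′) 1 (parent′ x)
    depth-parent′ (inj₁ _) = refl
    depth-parent′ (inj₂ v) = cong suc (trans (depth-parent F v) (sym (maybe′-∘ depth′ inj₂ (parent F v))))

  addRoot-child : ∀ {v u} → ChildOf F v u → ChildOf addRoot (inj₂ v) (inj₂ u)
  addRoot-child e = cong (just ∘ maybe′ inj₂ root) e

  addRoot-above : ∀ v → Descends addRoot (inj₂ v) root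
  addRoot-above v = above (depth F v) v refl
    where
    above : ∀ n v → depth F v ≡ n → Descends addRoot (inj₂ v) root
    above n v dv with parent F v in e
    above n       v dv | nothing = [ cong (just ∘ maybe′ inj₂ root) e ]
    above zero    v dv | just u  = ⊥-elim (0≢1+n (trans (sym dv) (child-depth F e)))
    above (suc n) v dv | just u  =
      addRoot-child e ◅ above n u (suc-injective (trans (sym (child-depth F e)) dv))

  addRoot-depth≤ : ∀ {t} → (∀ v → depth F v ≤ t) → ∀ x → depth addRoot x ≤ suc t
  addRoot-depth≤ depth≤ (inj₁ _) = s≤s z≤n
  addRoot-depth≤ depth≤ (inj₂ v) = s≤s (depth≤ v)

Chain : ℕ → Set → Set
Chain zero    V = V
Chain (suc s) V = ⊤ ⊎ Chain s V

chain : ∀ {V} s → Forest V → Forest (Chain s V)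
chain zero    F = F
chain (suc s) F = addRoot (chain s F)

lower : ∀ {V} s → V → Chain s V
lower zero    v = v
lower (suc s) v = inj₂ (lower s v)

chainVertex : ∀ {V} s → Fin s → Chain s V
chainVertex (suc s) zero    = root
chainVertex (suc s) (suc r) = inj₂ (chainVertex s r)

inj₂-injective : ∀ {A B : Set} {x y : B} → inj₂ {A = A} x ≡ inj₂ y → x ≡ y
inj₂-injective refl = refl

lower-injective : ∀ {V} s → Injective _≡_ _≡_ (lower {V} s)
lower-injective zero    = λ e → e
lower-injective (suc s) = lower-injective s ∘ inj₂-injective

chainVertex-injective : ∀ {V} s → Injective _≡_ _≡_ (chainVertex {V} s)
chainVertex-injective (suc s) {zero}  {zero}  _ = refl
chainVertex-injective (suc s) {suc r} {suc r′} e = cong suc (chainVertex-injective s (inj₂-injective e))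

module _ {V : Set} (F : Forest V) where

  chain-child : ∀ s {v u} → ChildOf F v u → ChildOf (chain s F) (lower s v) (lower s u)
  chain-child zero    e = e
  chain-child (suc s) e = addRoot-child (chain s F) (chain-child s e)

  chain-above : ∀ s r v → Descends (chain s F) (lower s v) (chainVertex s r)
  chain-above (suc s) zero    v = addRoot-above (chain s F) (lower s v)
  chain-above (suc s) (suc r) v =
    Descends-map (chain s F) (addRoot (chain s F)) inj₂ (addRoot-child (chain s F)) (chain-above s r v)

  chain-depth≤ : ∀ s {t} → (∀ v → depth F v ≤ t) → ∀ x → depth (chain s F) x ≤ s + t
  chain-depth≤ zero    depth≤ = depth≤
  chain-depth≤ (suc s) depth≤ = addRoot-depth≤ (chain s F) (chain-depth≤ s depth≤)

Chain↔ : ∀ {V k} s → V ↔ Fin k → Chain s V ↔ Fin (s + k)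
Chain↔ zero    I = I
Chain↔ (suc s) I = ↔-trans (↔-sym 1↔⊤ ⊎-↔ Chain↔ s I) (↔-sym +↔⊎)

×↔ : ∀ {V : Set} {k} b → V ↔ Fin k → (Fin b × V) ↔ Fin (b * k)
×↔ b I = ↔-trans (↔-refl ×-↔ I) (↔-sym *↔×)

-- Towers

module Tower (b s : ℕ) where

  Vertex : ℕ → Set
  Vertex zero    = ⊥
  Vertex (suc d) = Fin b × Chain s (Vertex d)

  tower : ∀ d → Forest (Vertex d)
  tower zero    = emptyForest
  tower (suc d) = copies b (chain s (tower d))

  tower-depth≤ : ∀ d v → depth (tower d) v ≤ d * s
  tower-depth≤ (suc d) (_ , x) = chain-depth≤ (tower d) s (tower-depth≤ d) x

  size : ℕ → ℕ
  size zero    = 0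
  size (suc d) = b * (s + size d)

  Vertex↔Fin : ∀ d → Vertex d ↔ Fin (size d)
  Vertex↔Fin zero    = ↔-sym 0↔⊥
  Vertex↔Fin (suc d) = ×↔ b (Chain↔ s (Vertex↔Fin d))

  size-lower : ∀ d → b ^ suc d * s ≤ size (suc d)
  size-lower zero    = ≤-reflexive (base b s)
    where
    base : ∀ b s → b * 1 * s ≡ b * (s + 0)
    base = solve-∀
  size-lower (suc d) = begin
    b * b ^ suc d * s        ≡⟨ *-assoc b (b ^ suc d) s ⟩
    b * (b ^ suc d * s)      ≤⟨ *-monoʳ-≤ b (size-lower d) ⟩
    b * size (suc d)         ≤⟨ *-monoʳ-≤ b (m≤n+m (size (suc d)) s) ⟩
    b * (s + size (suc d))   ∎
    where open ≤-Reasoning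

  size-upper : 2 ≤ b → ∀ d → size d ≤ 2 * (b ^ d * s)
  size-upper 2≤b d = ≤-trans (m≤m+n (size d) (2 * s)) (upper d)
    where
    open ≤-Reasoning
    upper : ∀ d → size d + 2 * s ≤ 2 * (b ^ d * s)
    upper zero    = ≤-reflexive (cong (2 *_) (sym (*-identityˡ s)))
    upper (suc d) = begin
      b * (s + size d) + 2 * s       ≤⟨ +-monoʳ-≤ (b * (s + size d)) (*-monoˡ-≤ s 2≤b) ⟩
      b * (s + size d) + b * s       ≡⟨ sym (*-distribˡ-+ b (s + size d) s) ⟩
      b * (s + size d + s)           ≡⟨ cong (b *_) (regroup s (size d)) ⟩
      b * (size d + 2 * s)           ≤⟨ *-monoʳ-≤ b (upper d) ⟩
      b * (2 * (b ^ d * s))          ≡⟨ shift b (b ^ d) s ⟩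
      2 * (b * b ^ d * s)            ∎
      where
      regroup : ∀ s t → s + t + s ≡ t + 2 * s
      regroup = solve-∀
      shift : ∀ b x s → b * (2 * (x * s)) ≡ 2 * (b * x * s)
      shift = solve-∀

  copyOf : Fin (b * s) → Fin b
  copyOf x = proj₁ (remQuot {b} s x)

  module Layer (d : ℕ) where

    top : Fin (b * s) → Vertex (suc d)
    top x = copyOf x , chainVertex s (proj₂ (remQuot {b} s x))

    below : Fin b → Vertex d → Vertex (suc d)
    below a y = a , lower s y

    top-injective : Injective _≡_ _≡_ top
    top-injective e =
      ↔-injective (*↔× {b} {s}) (cong₂ _,_ (cong proj₁ e) (chainVertex-injective s (cong proj₂ e)))

    top-above : ∀ x y → Descends (tower (suc d)) (below (copyOf x) y) (top x)
    top-above x y =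
      Descends-map (chain s (tower d)) (tower (suc d)) (copyOf x ,_)
                   (copies-child b (chain s (tower d)) (copyOf x))
                   (chain-above (tower d) s (proj₂ (remQuot {b} s x)) y)

    below-Contained : (a : Fin b) → Contained (closure (tower d)) (closure (tower (suc d)))
    below-Contained a =
      closure-map (tower d) (tower (suc d)) (below a) (lower-injective s ∘ cong proj₂)
                  (λ e → copies-child b (chain s (tower d)) a (chain-child (tower d) s e))

  module _ {h} (H : Graph (Fin h)) (m : ℕ) where

    InCommonClosedNbhd : ∀ {i} → (Fin i → Fin h) → Fin h → Set
    InCommonClosedNbhd S w = ∀ j → ReflClosure (E H) w (S j)

    tower-clique : ∀ d {i} ((f , _) : Contained (closure (tower d)) (H ⊠ K m)) (C : Clique H i) →
                   (∀ y → InCommonClosedNbhd (proj₁ C) (proj₁ (f y))) →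
                   (i + d) * m < b * s → Clique H (i + d)
    tower-clique zero    {i} _ C _ _ = subst (Clique H) (sym (+-identityʳ i)) C
    tower-clique (suc d) {i} emb@(f , f-inj , f-hom) C@(S , _) near bound =
      subst (Clique H) (sym (+-suc i d)) (tower-clique d emb′ C′ near′ bound′)
      where
      open Layer d
      im<bs : i * m < b * s
      im<bs = ≤-<-trans (*-monoˡ-≤ m (m≤m+n i (suc d))) bound
      fresh : ∃ λ x → ∀ j → proj₁ (f (top x)) ≢ S j
      fresh = outside-image im<bs (f ∘ top) (top-injective ∘ f-inj) S
      x : Fin (b * s)
      x = proj₁ fresh
      w : Fin h
      w = proj₁ (f (top x))
      C′ : Clique H (suc i)
      C′ = Clique-extend {H = H} C w λ j → drop-refl-≢ (proj₂ fresh j) (near (top x) j)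
      emb′ : Contained (closure (tower d)) (H ⊠ K m)
      emb′ = Contained-trans {G = closure (tower d)} {closure (tower (suc d))} {H ⊠ K m}
                             (below-Contained (copyOf x)) emb
      near′ : ∀ y → InCommonClosedNbhd (proj₁ C′) (proj₁ (proj₁ emb′ y))
      near′ y zero    = ⊠-proj₁ {A = H} {K m} (f-hom _ _ (inj₂ (top-above x y)))
      near′ y (suc j) = near (below (copyOf x) y) j
      bound′ : (suc i + d) * m < b * s
      bound′ = subst (λ l → l * m < b * s) (+-suc i d) bound

-- Choice of parameters

^-distribʳ-* : ∀ x y e → (x * y) ^ e ≡ x ^ e * y ^ e
^-distribʳ-* x y zero    = refl
^-distribʳ-* x y (suc e) =
  trans (cong (x * y *_) (^-distribʳ-* x y e)) ([m*n]*[o*p]≡[m*o]*[n*p] x y (x ^ e) (y ^ e))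

^-cancelʳ-< : ∀ e {x y} → x ^ e < y ^ e → x < y
^-cancelʳ-< e lt = ≰⇒> λ y≤x → <⇒≱ lt (^-monoˡ-≤ e y≤x)

module Construction (c N : ℕ) .{{_ : NonZero c}} where

  D B b s : ℕ
  D = suc N
  B = 2 * (D * c)
  b = B * B
  s = b ^ N

  instance
    Dc≢0 : NonZero (D * c)
    Dc≢0 = m*n≢0 D c
    B≢0 : NonZero B
    B≢0 = m*n≢0 2 (D * c)
    b≢0 : NonZero b
    b≢0 = m*n≢0 B B
    s≢0 : NonZero s
    s≢0 = m^n≢0 b N

  open Tower b s public

  n : ℕ
  n = size D

  I : Fin n ↔ Vertex D
  I = ↔-sym (Vertex↔Fin D)

  G : Graph (Fin n)
  G = comap (Inverse.to I) (closure (tower D))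

  2≤B : 2 ≤ B
  2≤B = m≤m*n 2 (D * c)

  2≤b : 2 ≤ b
  2≤b = ≤-trans 2≤B (m≤m*n B B)

  D≤B : D ≤ B
  D≤B = ≤-trans (m≤m*n D c) (m≤n*m (D * c) 2)

  n-lower : b * s * s ≤ n
  n-lower = size-lower N

  n-upper : n ≤ 2 * (b * s * s)
  n-upper = size-upper 2≤b D

  b≤n : b ≤ n
  b≤n = ≤-trans (m≤m*n b s) (≤-trans (m≤m*n (b * s) s) n-lower)

  N≤n : N ≤ n
  N≤n = ≤-trans (n≤1+n N) (≤-trans D≤B (≤-trans (m≤m*n B B) b≤n))

  0<n : 0 < n
  0<n = ≤-trans (>-nonZero⁻¹ b) b≤n

  treeDepth : Σ ℕ λ t → t * t ≤ n × TreeDepth≤ G t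
  treeDepth = D * s , square≤n ,
    TreeDepth≤-mono {G = G} {closure (tower D)} (comap-Contained I (closure (tower D)))
                    (closure-TreeDepth≤ (Vertex↔Fin D) (tower D) (tower-depth≤ D))
    where
    open ≤-Reasoning
    square≤n : D * s * (D * s) ≤ n
    square≤n = begin
      D * s * (D * s)   ≤⟨ *-mono-≤ (*-monoˡ-≤ s D≤B) (*-monoˡ-≤ s D≤B) ⟩
      B * s * (B * s)   ≡⟨ [m*n]*[o*p]≡[m*o]*[n*p] B s B s ⟩
      b * (s * s)       ≡⟨ sym (*-assoc b s s) ⟩
      b * s * s         ≤⟨ n-lower ⟩
      n                 ∎

  D*m<b*s : ∀ {m} → m * m ≤ c * c * n → D * m < b * s
  D*m<b*s {m} mm = ^-cancelʳ-< 2 (begin-strict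
      (D * m) ^ 2                     ≡⟨ square-* D m ⟩
      D * D * (m * m)                 ≤⟨ *-monoʳ-≤ (D * D) (≤-trans mm (*-monoʳ-≤ (c * c) n-upper)) ⟩
      D * D * (c * c * (2 * z))       ≡⟨ regroup D c z ⟩
      2 * y                           <⟨ *-monoˡ-< y {2} {4} (n≤1+n 3) ⟩
      4 * y                           ≡⟨ four-squares (D * c) s ⟩
      (b * s) ^ 2                     ∎)
    where
    open ≤-Reasoning
    z y : ℕ
    z = b * s * s
    y = D * c * (D * c) * z
    instance
      z≢0 : NonZero z
      z≢0 = m*n≢0 (b * s) s {{m*n≢0 b s}}
      y≢0 : NonZero y
      y≢0 = m*n≢0 (D * c * (D * c)) z {{m*n≢0 (D * c) (D * c)}}
    square-* : ∀ x m → x * m * (x * m * 1) ≡ x * x * (m * m)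
    square-* = solve-∀
    regroup : ∀ x c z → x * x * (c * c * (2 * z)) ≡ 2 * (x * c * (x * c) * z)
    regroup = solve-∀
    four-squares : ∀ q s →
      4 * (q * q * (2 * q * (2 * q) * s * s)) ≡ 2 * q * (2 * q) * s * (2 * q * (2 * q) * s * 1)
    four-squares = solve-∀

  n≤B^4D : n ≤ B ^ (4 * D)
  n≤B^4D = begin
    n                  ≤⟨ n-upper ⟩
    2 * (b * s * s)    ≤⟨ *-monoˡ-≤ (b * s * s) 2≤b ⟩
    b * (b * s * s)    ≡⟨ regroup b s ⟩
    b * s * (b * s)    ≡⟨ sym (^-distribʳ-* b b D) ⟩
    (b * b) ^ D        ≡⟨ cong (_^ D) (fourth-power B) ⟩
    (B ^ 4) ^ D        ≡⟨ ^-*-assoc B 4 D ⟩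
    B ^ (4 * D)        ∎
    where
    open ≤-Reasoning
    regroup : ∀ b s → b * (b * s * s) ≡ b * s * (b * s)
    regroup = solve-∀
    fourth-power : ∀ x → x * x * (x * x) ≡ x * (x * (x * (x * 1)))
    fourth-power = solve-∀

  logBound : LogBound n c D
  logBound p q _ pc^<nq^ = begin
    2 ^ p              ≤⟨ ^-monoʳ-≤ 2 (<⇒≤ p<2Dq) ⟩
    2 ^ (2 * D * q)    ≡⟨ sym (^-*-assoc 2 (2 * D) q) ⟩
    (2 ^ (2 * D)) ^ q  ≤⟨ ^-monoˡ-≤ q 2^2D≤n ⟩
    n ^ q              ∎
    where
    open ≤-Reasoning
    pc<Bq : p * c < B * q
    pc<Bq = ^-cancelʳ-< (4 * D) (begin-strict
      (p * c) ^ (4 * D)          <⟨ pc^<nq^ ⟩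
      n * q ^ (4 * D)            ≤⟨ *-monoˡ-≤ (q ^ (4 * D)) n≤B^4D ⟩
      B ^ (4 * D) * q ^ (4 * D)  ≡⟨ sym (^-distribʳ-* B q (4 * D)) ⟩
      (B * q) ^ (4 * D)          ∎)
    regroup : ∀ D c q → 2 * (D * c) * q ≡ 2 * D * q * c
    regroup = solve-∀
    p<2Dq : p < 2 * D * q
    p<2Dq = *-cancelʳ-< c p (2 * D * q) (subst (p * c <_) (regroup D c q) pc<Bq)
    2^2D≤n : 2 ^ (2 * D) ≤ n
    2^2D≤n = begin
      2 ^ (2 * D)   ≡⟨ sym (^-*-assoc 2 2 D) ⟩
      4 ^ D         ≤⟨ ^-monoˡ-≤ D (*-mono-≤ 2≤B 2≤B) ⟩
      b * s         ≤⟨ m≤m*n (b * s) s ⟩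
      b * s * s     ≤⟨ n-lower ⟩
      n             ∎

  clique : (h : ℕ) (H : Graph (Fin h)) (m : ℕ) → m * m ≤ c * c * n → Contained G (H ⊠ K m) →
           Σ ℕ λ k → HasClique H k × LogBound n c k
  clique h H m mm emb =
    D , Clique⇒HasClique {H = H} (tower-clique H m D {0} emb′ ((λ ()) , λ ()) (λ _ ()) (D*m<b*s mm)) ,
    logBound
    where
    emb′ : Contained (closure (tower D)) (H ⊠ K m)
    emb′ = Contained-trans {G = closure (tower D)} {G} {H ⊠ K m}
                           (Contained-comap I (closure (tower D))) emb

proposition36 : (c N : ℕ) →
    Σ ℕ λ n → N ≤ n × Σ (Graph (Fin n)) λ G →
      (Σ ℕ λ t → t * t ≤ n × TreeDepth≤ G t) ×
      ((h : ℕ) (H : Graph (Fin h)) (m : ℕ) → m * m ≤ c * c * n →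
        Contained G (H ⊠ K m) →
        Σ ℕ λ k → HasClique H k × LogBound n c k)
proposition36 zero N = n , N≤n , G , treeDepth , vacuous
  where
  open Construction 1 N
  vacuous : (h : ℕ) (H : Graph (Fin h)) (m : ℕ) → m * m ≤ 0 → Contained G (H ⊠ K m) →
            Σ ℕ λ k → HasClique H k × LogBound n 0 k
  vacuous h H zero    _  emb = ⊥-elim (Contained-⊠K0 {G = G} {H} emb (fromℕ< 0<n))
  vacuous h H (suc m) () _
proposition36 c@(suc _) N = n , N≤n , G , treeDepth , clique
  where open Construction c N
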